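{- For any $n\geq1$, $w\in\{+,-\}^n$ and nonnegative integers $i,j,k$ with $i+j+k=n$, the restriction of $\bar\partial$ to $\mathcal{Q}^+_{w+,i,j,k}$ is a bijection from $\mathcal{Q}^+_{w+,i,j,k}$ onto the set \[\bigsqcup_{j'=0}^{j-1}\mathcal{Q}^-_{w,i+j-1-j',j',k}\ \sqcup\ \bigsqcup_{k'=0}^{k-1}\mathcal{Q}^+_{w,k-1-k',i+j,k'}.\]
   Context: A total cyclic order on a finite set $X$ is a set $Z$ of triples of distinct elements of $X$ such that: $(x,y,z)\in Z\Rightarrow (y,z,x)\in Z$; $(x,y,z)\in Z\Rightarrow (z,y,x)\notin Z$; $(x,y,z)\in Z$ and $(x,z,u)\in Z\Rightarrow (x,y,u)\in Z$; and for any three distinct $x,y,z$, either $(x,y,z)\in Z$ or $(z,y,x)\in Z$. For a total cyclic order $Z$ on $[m+1]$ ($m\geq3$), $\bar\partial(Z)$ is the total cyclic order on $[m]$ obtained by deleting from $Z$ all triples involving $m+1$. For $w=\epsilon_1\cdots\epsilon_{m-2}\in\{+,-\}^{m-2}$, $\mathcal{P}_w$ is the set of total cyclic orders $Z$ on $[m]$ such that for every $1\leq i\leq m-2$, $(i,i+1,i+2)\in Z$ if $\epsilon_i=+$ and $(i+2,i+1,i)\in Z$ if $\epsilon_i=-$; $\mathcal{Q}^+_w$ (resp. $\mathcal{Q}^-_w$) is the set of $Z\in\mathcal{P}_w$ with $(m-1,m,1)\in Z$ (resp. $(1,m,m-1)\in Z$). Let $c_Z(a,b)=\#\{x:(a,x,b)\in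 Z\}$ and $\tilde c_Z(y_1,\dots,y_p)=(c_Z(y_1,y_2),\dots,c_Z(y_{p-1},y_p),c_Z(y_p,y_1))$. For $w\in\{+,-\}^{m-2}$ and nonnegative $i,j,k$ with $i+j+k=m-3$, $\mathcal{Q}^+_{w,i,j,k}=\{Z\in\mathcal{Q}^+_w:\tilde c_Z(m-1,m,1)=(i,j,k)\}$ and $\mathcal{Q}^-_{w,i,j,k}=\{Z\in\mathcal{Q}^-_w:\tilde c_Z(m,m-1,1)=(i,j,k)\}$. The word $w+$ is $w$ with the letter $+$ appended. -}

module Defs where

open import Data.Nat using (ℕ; zero; suc; _+_; _∸_; _<_; _≤_)
open import Data.Fin using (Fin; zero; suc; inject₁; fromℕ)
open import Data.List using (length; filterᵇ; allFin)
open import Data.Vec using (Vec; lookup)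
open import Data.Empty using (⊥)
open import Data.Bool using (Bool; true; false)
open import Data.Product using (Σ; _×_; _,_)
open import Data.Sum using (_⊎_)
open import Relation.Binary.PropositionalEquality using (_≡_; _≢_)

Triples : ℕ → Set
Triples N = Fin N → Fin N → Fin N → Bool

_∈₃_ : ∀ {N} → Fin N × Fin N × Fin N → Triples N → Set
(x , y , z) ∈₃ Z = Z x y z ≡ true

_≐_ : ∀ {N} → Triples N → Triples N → Set
Z ≐ Z' = ∀ x y z → Z x y z ≡ Z' x y z

record IsTotalCyclicOrder {N : ℕ} (Z : Triples N) : Set where
  field
    distinct : ∀ x y z → (x , y , z) ∈₃ Z → (x ≢ y) × (y ≢ z) × (x ≢ z)
    cyclic   : ∀ x y z → (x , y , z) ∈₃ Z → (y , z , x) ∈₃ Z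
    asym     : ∀ x y z → (x , y , z) ∈₃ Z → (z , y , x) ∈₃ Z → ⊥
    trans    : ∀ x y z u → (x , y , z) ∈₃ Z → (x , z , u) ∈₃ Z → (x , y , u) ∈₃ Z
    total    : ∀ x y z → x ≢ y → y ≢ z → x ≢ z → ((x , y , z) ∈₃ Z) ⊎ ((z , y , x) ∈₃ Z)

-- ∂̄ : delete all triples involving the last element m+1 (0-based: fromℕ m)
∂̄ : ∀ {m} → Triples (suc m) → Triples m
∂̄ Z x y z = Z (inject₁ x) (inject₁ y) (inject₁ z)

c : ∀ {N} → Triples N → Fin N → Fin N → ℕ
c {N} Z a b = length (filterᵇ (λ x → Z a x b) (allFin N))

data Sign : Set where
  plus minus : Sign

-- Elements of [m] with m = n + 2 are encoded 0-based as Fin (2 + n):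
-- element 1 is zero, element m-1 is inject₁ (fromℕ n), element m is fromℕ (suc n).
-- For t : Fin n (the letter index i = t+1), i, i+1, i+2 are
-- inject₁ (inject₁ t), suc (inject₁ t), suc (suc t).
P : ∀ {n} → Vec Sign n → Triples (2 + n) → Set
P {n} w Z = IsTotalCyclicOrder Z ×
  (∀ (t : Fin n) → letter (lookup w t) t)
  where
    letter : Sign → Fin n → Set
    letter plus  t = (inject₁ (inject₁ t) , suc (inject₁ t) , suc (suc t)) ∈₃ Z
    letter minus t = (suc (suc t) , suc (inject₁ t) , inject₁ (inject₁ t)) ∈₃ Z

one : ∀ {n} → Fin (2 + n)
one = zero

mm1 : ∀ {n} → Fin (2 + n)
mm1 {n} = inject₁ (fromℕ n)

mm : ∀ {n} → Fin (2 + n)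
mm {n} = fromℕ (suc n)

Qp : ∀ {n} → Vec Sign n → ℕ → ℕ → ℕ → Triples (2 + n) → Set
Qp w i j k Z = P w Z × (mm1 , mm , one) ∈₃ Z
  × c Z mm1 mm ≡ i × c Z mm one ≡ j × c Z one mm1 ≡ k

Qm : ∀ {n} → Vec Sign n → ℕ → ℕ → ℕ → Triples (2 + n) → Set
Qm w i j k Z = P w Z × (one , mm , mm1) ∈₃ Z
  × c Z mm mm1 ≡ i × c Z mm1 one ≡ j × c Z one mm ≡ k

Target : ∀ {n} → Vec Sign n → ℕ → ℕ → ℕ → Triples (2 + n) → Set
Target w i j k Z =
  (Σ ℕ λ j' → j' < j × Qm w (i + j ∸ suc j') j' k Z)
  ⊎ (Σ ℕ λ k' → k' < k × Qp w (k ∸ suc k') (i + j) k' Z)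

-- A total cyclic order Z is determined by the positions c Z b u of all points u relative to
-- any fixed point b: it is the cyclic order of the ranks 0 (for b) and 1 + c Z b u.
-- Deleting the new point m + 1 from Z shifts down exactly the positions, relative to m, of
-- the old points beyond it, so Z is recovered from ∂̄ Z and i = c Z m (m + 1); conversely
-- m + 1 can be inserted after the old points of position < i.  The orientation of
-- (m + 1, m − 1, 1) in Z decides between Q⁻ and Q⁺, and all counts are transported by
-- the additivity c Z x z = c Z x y + 1 + c Z y z for (x , y , z) ∈ Z.
module Submission where

open import Defs
open import Data.Nat using (ℕ; zero; suc; _+_; _*_; _∸_; _<_; _≤_; z≤n; s≤s; s≤s⁻¹; z<s; s<s)
open import Data.Nat.Properties
open import Data.Fin using (Fin; zero; suc; inject₁; fromℕ)
open import Data.Fin.Properties as Finₚ using (inject₁-injective; fromℕ≢inject₁) renaming (_≟_ to _≟ᶠ_)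
open import Data.List using (length; filterᵇ; tabulate)
open import Data.Vec using (Vec; []; _∷_; lookup; _∷ʳ_)
open import Data.Bool using (Bool; true; false; if_then_else_)
open import Data.Bool.Properties using (¬-not)
open import Data.Product using (Σ; _×_; _,_; proj₁; proj₂)
open import Data.Sum as Sum using (_⊎_; inj₁; inj₂)
open import Function using (_∘_; id; mk⇔)
open import Relation.Nullary using (¬_; Dec; yes; no; does; map′; _×-dec_; _⊎-dec_; contradiction)
open import Relation.Nullary.Decidable using (dec-true; dec-false; does-⇔)
open import Relation.Binary.PropositionalEquality
open import Relation.Binary.Definitions using (tri<; tri≈; tri>)
open import Algebra.Properties.CommutativeMonoid.Sum +-0-commutativeMonoid
  using (sum; ∑-distrib-+; sum-cong-≗; sum-init-last)

boolToℕ : Bool → ℕ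
boolToℕ true  = 1
boolToℕ false = 0

count : ∀ {N} → (Fin N → Bool) → ℕ
count p = sum (boolToℕ ∘ p)

does-sound : ∀ {A : Set} (a? : Dec A) → does a? ≡ true → A
does-sound (yes a) _ = a

length-filter-tabulate : ∀ {N M} (g : Fin N → Fin M) (p : Fin M → Bool) →
  length (filterᵇ p (tabulate g)) ≡ count (p ∘ g)
length-filter-tabulate {zero}  g p = refl
length-filter-tabulate {suc N} g p with p (g zero)
... | true  = cong suc (length-filter-tabulate (g ∘ suc) p)
... | false = length-filter-tabulate (g ∘ suc) p

c≡count : ∀ {N} (Z : Triples N) a b → c Z a b ≡ count (λ x → Z a x b)
c≡count Z a b = length-filter-tabulate id (λ x → Z a x b)

count-cong : ∀ {N} {p q : Fin N → Bool} → (∀ x → p x ≡ q x) → count p ≡ count q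
count-cong p≗q = sum-cong-≗ (cong boolToℕ ∘ p≗q)

count-false : ∀ {N} {p : Fin N → Bool} → (∀ x → p x ≡ false) → count p ≡ 0
count-false {zero}  p≡false = refl
count-false {suc N} p≡false rewrite p≡false zero = count-false (p≡false ∘ suc)

count-≤1 : ∀ {N} (p : Fin N → Bool) → (∀ x y → p x ≡ true → p y ≡ true → x ≡ y) → count p ≤ 1
count-≤1 {zero}  p unique = z≤n
count-≤1 {suc N} p unique with p zero in p₀
... | true  = ≤-reflexive (cong suc (count-false λ x →
  ¬-not λ pₓ → Finₚ.0≢1+n (unique zero (suc x) p₀ pₓ)))
... | false = count-≤1 (p ∘ suc) λ x y pₓ p_y → Finₚ.suc-injective (unique (suc x) (suc y) pₓ p_y)

count-≡ : ∀ {N} (y : Fin N) → count (λ u → does (u ≟ᶠ y)) ≡ 1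
count-≡ {suc N} zero    = cong suc (count-false {N} λ _ → refl)
count-≡ {suc N} (suc y) = count-≡ y

data Cyclic (p q r : ℕ) : Set where
  pqr : p < q → q < r → Cyclic p q r
  qrp : q < r → r < p → Cyclic p q r
  rpq : r < p → p < q → Cyclic p q r

cyclic? : ∀ p q r → Dec (Cyclic p q r)
cyclic? p q r = map′ fromSum toSum
  ((p <? q ×-dec q <? r) ⊎-dec ((q <? r ×-dec r <? p) ⊎-dec (r <? p ×-dec p <? q)))
  where
  fromSum : (p < q × q < r) ⊎ (q < r × r < p) ⊎ (r < p × p < q) → Cyclic p q r
  fromSum (inj₁ (a , b))        = pqr a b
  fromSum (inj₂ (inj₁ (a , b))) = qrp a b
  fromSum (inj₂ (inj₂ (a , b))) = rpq a b
  toSum : Cyclic p q r → (p < q × q < r) ⊎ (q < r × r < p) ⊎ (r < p × p < q)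
  toSum (pqr a b) = inj₁ (a , b)
  toSum (qrp a b) = inj₂ (inj₁ (a , b))
  toSum (rpq a b) = inj₂ (inj₂ (a , b))

cyclicᵇ : ℕ → ℕ → ℕ → Bool
cyclicᵇ p q r = does (cyclic? p q r)

cyclic-rotate : ∀ {p q r} → Cyclic p q r → Cyclic q r p
cyclic-rotate (pqr a b) = rpq a b
cyclic-rotate (qrp a b) = pqr a b
cyclic-rotate (rpq a b) = qrp a b

cyclic-asym : ∀ {p q r} → Cyclic p q r → ¬ Cyclic r q p
cyclic-asym (pqr a _) (pqr _ d) = <-asym a d
cyclic-asym (pqr a _) (qrp c _) = <-asym a c
cyclic-asym (pqr _ b) (rpq _ d) = <-asym b d
cyclic-asym (qrp a _) (pqr c _) = <-asym a c
cyclic-asym (qrp _ b) (qrp _ d) = <-asym b d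
cyclic-asym (qrp a _) (rpq _ d) = <-asym a d
cyclic-asym (rpq _ b) (pqr _ d) = <-asym b d
cyclic-asym (rpq _ b) (qrp c _) = <-asym b c
cyclic-asym (rpq a _) (rpq c _) = <-asym a c

cyclic-trans : ∀ {x y z u} → Cyclic x y z → Cyclic x z u → Cyclic x y u
cyclic-trans (pqr a b) (pqr _ d) = pqr a (<-trans b d)
cyclic-trans (pqr a b) (qrp c d) = contradiction (<-trans a b) (<-asym (<-trans c d))
cyclic-trans (pqr a _) (rpq c _) = rpq c a
cyclic-trans (qrp _ b) (pqr c _) = contradiction c (<-asym b)
cyclic-trans (qrp a _) (qrp c d) = qrp (<-trans a c) d
cyclic-trans (qrp _ b) (rpq _ d) = contradiction d (<-asym b)
cyclic-trans (rpq a _) (pqr c _) = contradiction c (<-asym a)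
cyclic-trans (rpq _ b) (qrp _ d) = rpq d b
cyclic-trans (rpq a _) (rpq _ d) = contradiction d (<-asym a)

cyclic-total : ∀ p q r → p ≢ q → q ≢ r → p ≢ r → Cyclic p q r ⊎ Cyclic r q p
cyclic-total p q r p≢q q≢r p≢r with <-cmp p q | <-cmp q r | <-cmp p r
... | tri≈ _ e _ | _          | _          = contradiction e p≢q
... | _          | tri≈ _ e _ | _          = contradiction e q≢r
... | _          | _          | tri≈ _ e _ = contradiction e p≢r
... | tri< a _ _ | tri< b _ _ | _          = inj₁ (pqr a b)
... | tri< _ _ _ | tri> _ _ b | tri< c _ _ = inj₂ (rpq c b)
... | tri< a _ _ | tri> _ _ _ | tri> _ _ c = inj₁ (rpq c a)
... | tri> _ _ a | tri< _ _ _ | tri< c _ _ = inj₂ (qrp a c)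
... | tri> _ _ _ | tri< b _ _ | tri> _ _ c = inj₁ (qrp b c)
... | tri> _ _ a | tri> _ _ b | _          = inj₂ (pqr b a)

cyclic-irrefl₁₂ : ∀ {p r} → ¬ Cyclic p p r
cyclic-irrefl₁₂ c = cyclic-asym c (cyclic-rotate (cyclic-rotate c))

cyclic-irrefl₂₃ : ∀ {p q} → ¬ Cyclic p q q
cyclic-irrefl₂₃ c = cyclic-asym c (cyclic-rotate c)

cyclic-irrefl₁₃ : ∀ {p q} → ¬ Cyclic p q p
cyclic-irrefl₁₃ c = cyclic-asym c c

cyclic-map : ∀ {f : ℕ → ℕ} → (∀ {a b} → a < b → f a < f b) →
  ∀ {p q r} → Cyclic p q r → Cyclic (f p) (f q) (f r)
cyclic-map mono (pqr a b) = pqr (mono a) (mono b)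
cyclic-map mono (qrp a b) = qrp (mono a) (mono b)
cyclic-map mono (rpq a b) = rpq (mono a) (mono b)

cyclic-reflect : ∀ {f : ℕ → ℕ} → (∀ {a b} → f a < f b → a < b) →
  ∀ {p q r} → Cyclic (f p) (f q) (f r) → Cyclic p q r
cyclic-reflect refl< (pqr a b) = pqr (refl< a) (refl< b)
cyclic-reflect refl< (qrp a b) = qrp (refl< a) (refl< b)
cyclic-reflect refl< (rpq a b) = rpq (refl< a) (refl< b)

cyclicᵇ-double : ∀ p q r → cyclicᵇ (2 * p) (2 * q) (2 * r) ≡ cyclicᵇ p q r
cyclicᵇ-double p q r = does-⇔
  (mk⇔ (cyclic-reflect (*-cancelˡ-< 2 _ _)) (cyclic-map (*-monoʳ-< 2)))
  (cyclic? (2 * p) (2 * q) (2 * r)) (cyclic? p q r)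

unit-steps-fixpoint : (f : ℕ → ℕ) → f 0 ≡ 0 → (∀ p → f (suc p) ≤ suc (f p)) →
  ∀ {p q} → p ≤ q → f q ≡ q → f p ≡ p
unit-steps-fixpoint f f0 step {p} {q} p≤q fq = ≤-antisym (upper p) (lower (q ∸ p) fq′)
  where
  upper : ∀ p → f p ≤ p
  upper zero    = ≤-reflexive f0
  upper (suc p) = ≤-trans (step p) (s≤s (upper p))
  lower : ∀ d {p} → f (p + d) ≡ p + d → p ≤ f p
  lower zero    {p} fp rewrite +-identityʳ p = ≤-reflexive (sym fp)
  lower (suc d) {p} fp rewrite +-suc p d = s≤s⁻¹ (≤-trans (lower d fp) (step p))
  fq′ : f (p + (q ∸ p)) ≡ p + (q ∸ p)
  fq′ rewrite m+[n∸m]≡n p≤q = fq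

<-suc-split : ∀ a p → boolToℕ (does (a <? suc p)) ≡ boolToℕ (does (a <? p)) + boolToℕ (does (a ≟ p))
<-suc-split zero    zero    = refl
<-suc-split zero    (suc p) = refl
<-suc-split (suc a) zero    = refl
<-suc-split (suc a) (suc p) = <-suc-split a p

cong₃ : ∀ {A : Set} (f : ℕ → ℕ → ℕ → A) {a a′ b b′ d d′} →
  a ≡ a′ → b ≡ b′ → d ≡ d′ → f a b d ≡ f a′ b′ d′
cong₃ f refl refl refl = refl

rankOrder : ∀ {N} → (Fin N → ℕ) → Triples N
rankOrder r x y z = cyclicᵇ (r x) (r y) (r z)

rankOrder-isTotalCyclicOrder : ∀ {N} {r : Fin N → ℕ} → (∀ {x y} → r x ≡ r y → x ≡ y) →
  IsTotalCyclicOrder (rankOrder r)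
rankOrder-isTotalCyclicOrder {r = r} r-injective = record
  { distinct = λ x y z xyz → let cyc = sound xyz in
      (λ { refl → cyclic-irrefl₁₂ cyc }) ,
      (λ { refl → cyclic-irrefl₂₃ cyc }) ,
      (λ { refl → cyclic-irrefl₁₃ cyc })
  ; cyclic   = λ x y z xyz → complete (cyclic-rotate (sound xyz))
  ; asym     = λ x y z xyz zyx → cyclic-asym (sound xyz) (sound zyx)
  ; trans    = λ x y z u xyz xzu → complete (cyclic-trans (sound xyz) (sound xzu))
  ; total    = λ x y z x≢y y≢z x≢z → Sum.map complete complete
      (cyclic-total _ _ _ (x≢y ∘ r-injective) (y≢z ∘ r-injective) (x≢z ∘ r-injective))
  }
  where
  sound : ∀ {x y z} → (x , y , z) ∈₃ rankOrder r → Cyclic (r x) (r y) (r z)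
  sound = does-sound (cyclic? _ _ _)
  complete : ∀ {x y z} → Cyclic (r x) (r y) (r z) → (x , y , z) ∈₃ rankOrder r
  complete = dec-true (cyclic? _ _ _)

rankOrder-cong : ∀ {N} {r r′ : Fin N → ℕ} → (∀ u → r u ≡ r′ u) → rankOrder r ≐ rankOrder r′
rankOrder-cong r≗r′ x y z = cong₃ cyclicᵇ (r≗r′ x) (r≗r′ y) (r≗r′ z)

module TotalCyclicOrder {N : ℕ} {Z : Triples N} (tco : IsTotalCyclicOrder Z) where
  private module T = IsTotalCyclicOrder tco

  rotate : ∀ {x y z} → (x , y , z) ∈₃ Z → (y , z , x) ∈₃ Z
  rotate = T.cyclic _ _ _

  asym : ∀ {x y z} → (x , y , z) ∈₃ Z → ¬ (z , y , x) ∈₃ Z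
  asym = T.asym _ _ _

  transitive : ∀ {x y z u} → (x , y , z) ∈₃ Z → (x , z , u) ∈₃ Z → (x , y , u) ∈₃ Z
  transitive = T.trans _ _ _ _

  total : ∀ {x y z} → x ≢ y → y ≢ z → x ≢ z → (x , y , z) ∈₃ Z ⊎ (z , y , x) ∈₃ Z
  total = T.total _ _ _

  distinct₁₂ : ∀ {x y z} → (x , y , z) ∈₃ Z → x ≢ y
  distinct₁₂ = proj₁ ∘ T.distinct _ _ _

  distinct₂₃ : ∀ {x y z} → (x , y , z) ∈₃ Z → y ≢ z
  distinct₂₃ = proj₁ ∘ proj₂ ∘ T.distinct _ _ _

  distinct₁₃ : ∀ {x y z} → (x , y , z) ∈₃ Z → x ≢ z
  distinct₁₃ = proj₂ ∘ proj₂ ∘ T.distinct _ _ _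

  ∉-repeat₁₂ : ∀ x y → Z x x y ≡ false
  ∉-repeat₁₂ x y = ¬-not λ xxy → distinct₁₂ xxy refl

  ∉-repeat₂₃ : ∀ x y → Z x y y ≡ false
  ∉-repeat₂₃ x y = ¬-not λ xyy → distinct₂₃ xyy refl

  ∉-reverse : ∀ {x y z} → (x , y , z) ∈₃ Z → Z z y x ≡ false
  ∉-reverse xyz = ¬-not (asym xyz)

  between-split : ∀ {x y z} → (x , y , z) ∈₃ Z → ∀ u →
    boolToℕ (Z x u z) ≡ boolToℕ (Z x u y) + boolToℕ (does (u ≟ᶠ y)) + boolToℕ (Z y u z)
  between-split {x} {y} {z} xyz u with u ≟ᶠ y
  ... | yes refl rewrite xyz | ∉-repeat₂₃ x u | ∉-repeat₁₂ u z = refl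
  ... | no u≢y with Z x u y in xuy | Z y u z in yuz
  ... | true  | true  = contradiction (rotate xuy) (asym (rotate (rotate (transitive yuz (rotate xyz)))))
  ... | true  | false rewrite transitive xuy xyz = refl
  ... | false | true  rewrite rotate (transitive (rotate (rotate xyz)) (rotate (rotate yuz))) = refl
  ... | false | false with Z x u z in xuz
  ... | false = refl
  ... | true with total (distinct₁₂ xuz) u≢y (distinct₁₂ xyz)
               | total (u≢y ∘ sym) (distinct₂₃ xuz) (distinct₂₃ xyz)
  ...   | inj₁ xuy′ | _         = contradiction (trans (sym xuy) xuy′) λ ()
  ...   | inj₂ _    | inj₁ yuz′ = contradiction (trans (sym yuz) yuz′) λ ()
  ...   | inj₂ yux  | inj₂ zuy  = contradiction (rotate (rotate xuz)) (asym (transitive (rotate yux) (rotate zuy)))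

  c-additive : ∀ {x y z} → (x , y , z) ∈₃ Z → c Z x z ≡ c Z x y + suc (c Z y z)
  c-additive {x} {y} {z} xyz = begin
    c Z x z                                                     ≡⟨ c≡count Z x z ⟩
    sum (λ u → boolToℕ (Z x u z))                               ≡⟨ sum-cong-≗ (between-split xyz) ⟩
    sum (λ u → boolToℕ (Z x u y) + boolToℕ (does (u ≟ᶠ y)) + boolToℕ (Z y u z))
      ≡⟨ ∑-distrib-+ (λ u → boolToℕ (Z x u y) + boolToℕ (does (u ≟ᶠ y))) _ ⟩
    sum (λ u → boolToℕ (Z x u y) + boolToℕ (does (u ≟ᶠ y))) + count (λ u → Z y u z)
      ≡⟨ cong (_+ count (λ u → Z y u z)) (∑-distrib-+ (λ u → boolToℕ (Z x u y)) _) ⟩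
    count (λ u → Z x u y) + count (λ u → does (u ≟ᶠ y)) + count (λ u → Z y u z)
      ≡⟨ cong₃ (λ a e b → a + e + b) (sym (c≡count Z x y)) (count-≡ y) (sym (c≡count Z y z)) ⟩
    c Z x y + 1 + c Z y z                                       ≡⟨ +-assoc (c Z x y) 1 (c Z y z) ⟩
    c Z x y + suc (c Z y z)                                     ∎
    where open ≡-Reasoning

  c-strict : ∀ {b y z} → (b , y , z) ∈₃ Z → c Z b y < c Z b z
  c-strict {b} {y} {z} byz = subst (c Z b y <_) (sym (c-additive byz)) (m<m+n (c Z b y) z<s)

  Z≡c<? : ∀ {b y z} → b ≢ y → y ≢ z → b ≢ z → Z b y z ≡ does (c Z b y <? c Z b z)
  Z≡c<? b≢y y≢z b≢z with total b≢y y≢z b≢z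
  ... | inj₁ byz = trans byz (sym (dec-true (_ <? _) (c-strict byz)))
  ... | inj₂ zyb = trans (∉-reverse zyb) (sym (dec-false (_ <? _) (<-asym (c-strict (rotate (rotate zyb))))))

  -- Position of an element when the circle is cut open at b.
  module Rank (b : Fin N) where
    rank : Fin N → ℕ
    rank u = if does (u ≟ᶠ b) then 0 else suc (c Z b u)

    rank-base : rank b ≡ 0
    rank-base rewrite dec-true (b ≟ᶠ b) refl = refl

    rank-other : ∀ {u} → u ≢ b → rank u ≡ suc (c Z b u)
    rank-other u≢b rewrite dec-false (_ ≟ᶠ b) u≢b = refl

    rank-injective : ∀ {x y} → rank x ≡ rank y → x ≡ y
    rank-injective {x} {y} eq with x ≟ᶠ b | y ≟ᶠ b
    ... | yes refl | yes refl = refl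
    ... | yes refl | no _     with () ← eq
    ... | no _     | yes refl with () ← eq
    ... | no x≢b   | no y≢b   with x ≟ᶠ y
    ... | yes x≡y = x≡y
    ... | no x≢y with total (x≢b ∘ sym) x≢y (y≢b ∘ sym)
    ...   | inj₁ bxy = contradiction (suc-injective eq) (<⇒≢ (c-strict bxy))
    ...   | inj₂ yxb = contradiction (suc-injective eq) (>⇒≢ (c-strict (rotate (rotate yxb))))

    private
      rank-cyclic-from-base : ∀ {y z} → (b , y , z) ∈₃ Z → Cyclic (rank b) (rank y) (rank z)
      rank-cyclic-from-base byz
        rewrite rank-base | rank-other (distinct₁₂ byz ∘ sym) | rank-other (distinct₁₃ byz ∘ sym) =
        pqr z<s (s<s (c-strict byz))

      rank-cyclic-across-base : ∀ {x y z} → (x , y , z) ∈₃ Z → (x , b , y) ∈₃ Z →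
        x ≢ b → y ≢ b → z ≢ b → Cyclic (rank x) (rank y) (rank z)
      rank-cyclic-across-base {x} {y} {z} xyz xby x≢b y≢b z≢b
        rewrite rank-other x≢b | rank-other y≢b | rank-other z≢b =
        qrp (s<s (c-strict byz)) (s<s (c-strict (rotate (transitive xby xyz))))
        where
        byz : (b , y , z) ∈₃ Z
        byz with total (y≢b ∘ sym) (distinct₂₃ xyz) (z≢b ∘ sym)
        ... | inj₁ byz = byz
        ... | inj₂ zyb = contradiction (rotate (rotate xby)) (asym (rotate (transitive (rotate zyb) (rotate xyz))))

      -- Some gap (x,y), (y,z) or (z,x) of the cyclic triple contains b; rotate it to the front.
      rank-cyclic-avoiding-base : ∀ {x y z} → (x , y , z) ∈₃ Z →
        x ≢ b → y ≢ b → z ≢ b → Cyclic (rank x) (rank y) (rank z)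
      rank-cyclic-avoiding-base xyz x≢b y≢b z≢b with total x≢b (y≢b ∘ sym) (distinct₁₂ xyz)
      ... | inj₁ xby = rank-cyclic-across-base xyz xby x≢b y≢b z≢b
      ... | inj₂ ybx with total y≢b (z≢b ∘ sym) (distinct₂₃ xyz)
      ... | inj₁ ybz = cyclic-rotate (cyclic-rotate (rank-cyclic-across-base (rotate xyz) ybz y≢b z≢b x≢b))
      ... | inj₂ zby with total z≢b (x≢b ∘ sym) (distinct₁₃ xyz ∘ sym)
      ... | inj₁ zbx = cyclic-rotate (rank-cyclic-across-base (rotate (rotate xyz)) zbx z≢b x≢b y≢b)
      ... | inj₂ xbz = contradiction (rotate (rotate xbz)) (asym (transitive (rotate ybx) (rotate zby)))

    rank-cyclic : ∀ {x y z} → (x , y , z) ∈₃ Z → Cyclic (rank x) (rank y) (rank z)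
    rank-cyclic {x} {y} {z} xyz = by-cases (x ≟ᶠ b) (y ≟ᶠ b) (z ≟ᶠ b)
      where
      by-cases : Dec (x ≡ b) → Dec (y ≡ b) → Dec (z ≡ b) → Cyclic (rank x) (rank y) (rank z)
      by-cases (yes refl) _          _          = rank-cyclic-from-base xyz
      by-cases (no _)     (yes refl) _          = cyclic-rotate (cyclic-rotate (rank-cyclic-from-base (rotate xyz)))
      by-cases (no _)     (no _)     (yes refl) = cyclic-rotate (rank-cyclic-from-base (rotate (rotate xyz)))
      by-cases (no x≢b)   (no y≢b)   (no z≢b)   = rank-cyclic-avoiding-base xyz x≢b y≢b z≢b

    ≐-rankOrder : Z ≐ rankOrder rank
    ≐-rankOrder x y z with Z x y z in xyz
    ... | true  = sym (dec-true (cyclic? _ _ _) (rank-cyclic xyz))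
    ... | false = sym (dec-false (cyclic? _ _ _) ¬cyclic)
      where
      ¬cyclic : ¬ Cyclic (rank x) (rank y) (rank z)
      ¬cyclic cyc with x ≟ᶠ y | y ≟ᶠ z | x ≟ᶠ z
      ... | yes refl | _        | _        = cyclic-irrefl₁₂ cyc
      ... | no _     | yes refl | _        = cyclic-irrefl₂₃ cyc
      ... | no _     | no _     | yes refl = cyclic-irrefl₁₃ cyc
      ... | no x≢y   | no y≢z   | no x≢z   with total x≢y y≢z x≢z
      ...   | inj₁ xyz′ = contradiction (trans (sym xyz) xyz′) λ ()
      ...   | inj₂ zyx  = cyclic-asym cyc (rank-cyclic zyx)

    below : ℕ → Fin N → Bool
    below p u = if does (u ≟ᶠ b) then false else does (c Z b u <? p)

    private
      at : ℕ → Fin N → Bool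
      at p u = if does (u ≟ᶠ b) then false else does (c Z b u ≟ p)

      at-rank : ∀ p u → at p u ≡ true → rank u ≡ suc p
      at-rank p u atpu with u ≟ᶠ b
      at-rank p u () | yes _
      ... | no _ = cong suc (does-sound (c Z b u ≟ p) atpu)

      count-below-suc : ∀ p → count (below (suc p)) ≤ suc (count (below p))
      count-below-suc p = begin
        count (below (suc p))                ≡⟨ sum-cong-≗ below-suc-split ⟩
        sum (λ u → boolToℕ (below p u) + boolToℕ (at p u)) ≡⟨ ∑-distrib-+ (boolToℕ ∘ below p) _ ⟩
        count (below p) + count (at p)       ≤⟨ +-monoʳ-≤ (count (below p)) (count-≤1 (at p) at-unique) ⟩
        count (below p) + 1                  ≡⟨ +-comm _ 1 ⟩
        suc (count (below p))                ∎
        where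
        open ≤-Reasoning
        below-suc-split : ∀ u → boolToℕ (below (suc p) u) ≡ boolToℕ (below p u) + boolToℕ (at p u)
        below-suc-split u with does (u ≟ᶠ b)
        ... | true  = refl
        ... | false = <-suc-split (c Z b u) p
        at-unique : ∀ x y → at p x ≡ true → at p y ≡ true → x ≡ y
        at-unique x y atx aty = rank-injective (trans (at-rank p x atx) (sym (at-rank p y aty)))

      below-c : ∀ {y} → y ≢ b → ∀ u → below (c Z b y) u ≡ Z b u y
      below-c {y} y≢b u with u ≟ᶠ b
      ... | yes refl = sym (∉-repeat₁₂ u y)
      ... | no u≢b with u ≟ᶠ y
      ...   | yes refl = trans (dec-false (c Z b u <? c Z b u) (<-irrefl refl)) (sym (∉-repeat₂₃ b u))
      ...   | no u≢y   = sym (Z≡c<? (u≢b ∘ sym) u≢y (y≢b ∘ sym))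

    -- Every value below c Z b y is the position of some element, so no threshold is skipped.
    count-below : ∀ {y p} → y ≢ b → p ≤ c Z b y → count (below p) ≡ p
    count-below {y} y≢b p≤c = unit-steps-fixpoint (count ∘ below) (count-false below-zero) count-below-suc
      p≤c (trans (count-cong (below-c y≢b)) (sym (c≡count Z b y)))
      where
      below-zero : ∀ u → below 0 u ≡ false
      below-zero u with does (u ≟ᶠ b)
      ... | true  = refl
      ... | false = dec-false (c Z b u <? 0) λ ()

data InitOrLast {N : ℕ} : Fin (suc N) → Set where
  init : (u : Fin N) → InitOrLast (inject₁ u)
  last : InitOrLast (fromℕ N)

initOrLast : ∀ {N} (x : Fin (suc N)) → InitOrLast x
initOrLast {zero}  zero    = last
initOrLast {suc N} zero    = init zero
initOrLast {suc N} (suc x) with initOrLast x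
... | init u = init (suc u)
... | last   = last

extend : ∀ {N} {A : Set} → (Fin N → A) → A → Fin (suc N) → A
extend {zero}  f v zero    = v
extend {suc N} f v zero    = f zero
extend {suc N} f v (suc x) = extend (f ∘ suc) v x

extend-inject₁ : ∀ {N} {A : Set} (f : Fin N → A) v x → extend f v (inject₁ x) ≡ f x
extend-inject₁ {suc N} f v zero    = refl
extend-inject₁ {suc N} f v (suc x) = extend-inject₁ (f ∘ suc) v x

extend-last : ∀ {N} {A : Set} (f : Fin N → A) v → extend f v (fromℕ N) ≡ v
extend-last {zero}  f v = refl
extend-last {suc N} f v = extend-last (f ∘ suc) v

c-cong : ∀ {N} {Z Z′ : Triples N} → Z ≐ Z′ → ∀ a b → c Z a b ≡ c Z′ a b
c-cong {Z = Z} {Z′} Z≐Z′ a b =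
  trans (c≡count Z a b) (trans (count-cong (λ u → Z≐Z′ a u b)) (sym (c≡count Z′ a b)))

∂̄-isTotalCyclicOrder : ∀ {N} {Z : Triples (suc N)} → IsTotalCyclicOrder Z → IsTotalCyclicOrder (∂̄ Z)
∂̄-isTotalCyclicOrder tco = record
  { distinct = λ x y z xyz → let (x≢y , y≢z , x≢z) = distinct _ _ _ xyz in
      x≢y ∘ cong inject₁ , y≢z ∘ cong inject₁ , x≢z ∘ cong inject₁
  ; cyclic   = λ x y z → cyclic _ _ _
  ; asym     = λ x y z → asym _ _ _
  ; trans    = λ x y z u → IsTotalCyclicOrder.trans tco _ _ _ _
  ; total    = λ x y z x≢y y≢z x≢z →
      total _ _ _ (x≢y ∘ inject₁-injective) (y≢z ∘ inject₁-injective) (x≢z ∘ inject₁-injective)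
  }
  where open IsTotalCyclicOrder tco hiding (trans)

c-∂̄ : ∀ {N} (Z : Triples (suc N)) a b →
  c Z (inject₁ a) (inject₁ b) ≡ c (∂̄ Z) a b + boolToℕ (Z (inject₁ a) (fromℕ N) (inject₁ b))
c-∂̄ {N} Z a b = begin
  c Z (inject₁ a) (inject₁ b)                         ≡⟨ c≡count Z _ _ ⟩
  count (λ x → Z (inject₁ a) x (inject₁ b))
    ≡⟨ sum-init-last (λ x → boolToℕ (Z (inject₁ a) x (inject₁ b))) ⟩
  count (λ x → ∂̄ Z a x b) + boolToℕ (Z (inject₁ a) (fromℕ N) (inject₁ b))
    ≡⟨ cong (_+ boolToℕ (Z (inject₁ a) (fromℕ N) (inject₁ b))) (sym (c≡count (∂̄ Z) a b)) ⟩
  c (∂̄ Z) a b + boolToℕ (Z (inject₁ a) (fromℕ N) (inject₁ b)) ∎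
  where open ≡-Reasoning

c-∂̄-inside : ∀ {N} (Z : Triples (suc N)) {a b} → (inject₁ a , fromℕ N , inject₁ b) ∈₃ Z →
  c Z (inject₁ a) (inject₁ b) ≡ suc (c (∂̄ Z) a b)
c-∂̄-inside Z {a} {b} aMb =
  trans (c-∂̄ Z a b) (trans (cong (λ t → c (∂̄ Z) a b + boolToℕ t) aMb) (+-comm _ 1))

c-∂̄-outside : ∀ {N} {Z : Triples (suc N)} → IsTotalCyclicOrder Z → ∀ {a b} →
  (inject₁ b , fromℕ N , inject₁ a) ∈₃ Z → c Z (inject₁ a) (inject₁ b) ≡ c (∂̄ Z) a b
c-∂̄-outside {Z = Z} tZ {a} {b} bMa =
  trans (c-∂̄ Z a b) (trans (cong (λ t → c (∂̄ Z) a b + boolToℕ t) (∉-reverse bMa)) (+-identityʳ _))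
  where open TotalCyclicOrder tZ

shifted-solution : ∀ {a i y} → y ≡ a + boolToℕ (does (i <? y)) → y ≢ i →
  y ≡ a + boolToℕ (does (i ≤? a))
shifted-solution {a} {i} {y} y≡ y≢i = by-cases (i <? y)
  where
  a+[_] : Bool → ℕ
  a+[ t ] = a + boolToℕ t
  by-cases : Dec (i < y) → y ≡ a+[ does (i ≤? a) ]
  by-cases (yes i<y) = begin
    y                    ≡⟨ y≡ ⟩
    a+[ does (i <? y) ]  ≡⟨ cong a+[_] (dec-true (i <? y) i<y) ⟩
    a + 1                ≡⟨ cong a+[_] (sym (dec-true (i ≤? a) i≤a)) ⟩
    a+[ does (i ≤? a) ]  ∎
    where
    open ≡-Reasoning
    i≤a : i ≤ a
    i≤a = s≤s⁻¹ (subst (i <_) (trans y≡ (trans (cong a+[_] (dec-true (i <? y) i<y)) (+-comm a 1))) i<y)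
  by-cases (no i≮y) = begin
    y                    ≡⟨ y≡ ⟩
    a+[ does (i <? y) ]  ≡⟨ cong a+[_] (dec-false (i <? y) i≮y) ⟩
    a + 0                ≡⟨ cong a+[_] (sym (dec-false (i ≤? a) (<⇒≱ a<i))) ⟩
    a+[ does (i ≤? a) ]  ∎
    where
    open ≡-Reasoning
    a<i : a < i
    a<i = subst (_< i) (trans y≡ (trans (cong a+[_] (dec-false (i <? y) i≮y)) (+-identityʳ a)))
            (≤∧≢⇒< (≮⇒≥ i≮y) y≢i)

module _ {N : ℕ} {Z : Triples (suc N)} (tco : IsTotalCyclicOrder Z) (b : Fin N) where
  open TotalCyclicOrder tco
  open Rank (inject₁ b)

  c-∂̄-last : ∀ {v} → v ≢ b → c Z (inject₁ b) (inject₁ v) ≡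
    c (∂̄ Z) b v + boolToℕ (does (c Z (inject₁ b) (fromℕ N) <? c Z (inject₁ b) (inject₁ v)))
  c-∂̄-last {v} v≢b = trans (c-∂̄ Z b v) (cong (λ t → c (∂̄ Z) b v + boolToℕ t)
    (Z≡c<? (fromℕ≢inject₁ ∘ sym) fromℕ≢inject₁ (v≢b ∘ sym ∘ inject₁-injective)))

  c-≢-last : ∀ {v} → v ≢ b → c Z (inject₁ b) (inject₁ v) ≢ c Z (inject₁ b) (fromℕ N)
  c-≢-last v≢b eq = fromℕ≢inject₁ (sym (rank-injective
    (trans (rank-other (v≢b ∘ inject₁-injective)) (trans (cong suc eq) (sym (rank-other fromℕ≢inject₁))))))

-- Relative to any old point b, the positions of the other old points are determined by ∂̄ Z
-- and the position of the last point (shifted-solution).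
∂̄-injective : ∀ {N} {Z Z′ : Triples (suc N)} → IsTotalCyclicOrder Z → IsTotalCyclicOrder Z′ →
  (b : Fin N) → c Z (inject₁ b) (fromℕ N) ≡ c Z′ (inject₁ b) (fromℕ N) →
  ∂̄ Z ≐ ∂̄ Z′ → Z ≐ Z′
∂̄-injective {N} {Z} {Z′} tZ tZ′ b cZ≡cZ′ ∂̄Z≐∂̄Z′ x y z =
  trans (R.≐-rankOrder x y z) (trans (rankOrder-cong rank≡ x y z) (sym (R′.≐-rankOrder x y z)))
  where
  open ≡-Reasoning
  module R  = TotalCyclicOrder.Rank tZ  (inject₁ b)
  module R′ = TotalCyclicOrder.Rank tZ′ (inject₁ b)
  c≡ : ∀ {v} → v ≢ b → c Z (inject₁ b) (inject₁ v) ≡ c Z′ (inject₁ b) (inject₁ v)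
  c≡ {v} v≢b = begin
    c Z (inject₁ b) (inject₁ v)
      ≡⟨ shifted-solution (c-∂̄-last tZ b v≢b) (c-≢-last tZ b v≢b) ⟩
    c (∂̄ Z) b v + boolToℕ (does (c Z (inject₁ b) (fromℕ N) ≤? c (∂̄ Z) b v))
      ≡⟨ cong₂ (λ a i → a + boolToℕ (does (i ≤? a))) (c-cong ∂̄Z≐∂̄Z′ b v) cZ≡cZ′ ⟩
    c (∂̄ Z′) b v + boolToℕ (does (c Z′ (inject₁ b) (fromℕ N) ≤? c (∂̄ Z′) b v))
      ≡⟨ sym (shifted-solution (c-∂̄-last tZ′ b v≢b) (c-≢-last tZ′ b v≢b)) ⟩
    c Z′ (inject₁ b) (inject₁ v) ∎
  rank≡ : ∀ u → R.rank u ≡ R′.rank u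
  rank≡ u with initOrLast u
  ... | last = trans (R.rank-other fromℕ≢inject₁)
                 (trans (cong suc cZ≡cZ′) (sym (R′.rank-other fromℕ≢inject₁)))
  ... | init v with v ≟ᶠ b
  ...   | yes refl = trans R.rank-base (sym R′.rank-base)
  ...   | no v≢b   = trans (R.rank-other (v≢b ∘ inject₁-injective))
                       (trans (cong suc (c≡ v≢b)) (sym (R′.rank-other (v≢b ∘ inject₁-injective))))

module Insertion {N : ℕ} {Y : Triples N} (tY : IsTotalCyclicOrder Y) (b : Fin N) (p : ℕ) where
  open TotalCyclicOrder tY
  open Rank b

  -- Doubling the ranks leaves the odd value 2p + 1 free for the new last point,
  -- just after the old points with position < p relative to b.
  newRank : Fin (suc N) → ℕ
  newRank = extend (λ u → 2 * rank u) (suc (2 * p))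

  insert : Triples (suc N)
  insert = rankOrder newRank

  private
    newRank-old : ∀ u → newRank (inject₁ u) ≡ 2 * rank u
    newRank-old = extend-inject₁ (λ u → 2 * rank u) (suc (2 * p))

    newRank-last : newRank (fromℕ N) ≡ suc (2 * p)
    newRank-last = extend-last (λ u → 2 * rank u) (suc (2 * p))

    newRank-injective : ∀ {x y} → newRank x ≡ newRank y → x ≡ y
    newRank-injective {x} {y} eq with initOrLast x | initOrLast y
    ... | init u | init v =
      cong inject₁ (rank-injective (*-cancelˡ-≡ _ _ 2 (trans (sym (newRank-old u)) (trans eq (newRank-old v)))))
    ... | init u | last   =
      contradiction (trans (sym (newRank-old u)) (trans eq newRank-last)) (even≢odd (rank u) p)
    ... | last   | init v =
      contradiction (trans (sym (newRank-old v)) (trans (sym eq) newRank-last)) (even≢odd (rank v) p)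
    ... | last   | last   = refl

    old-below-last : ∀ u → insert (inject₁ b) (inject₁ u) (fromℕ N) ≡ below p u
    old-below-last u rewrite newRank-old b | newRank-old u | newRank-last | rank-base with u ≟ᶠ b
    ... | yes refl = dec-false (cyclic? 0 0 (suc (2 * p))) cyclic-irrefl₁₂
    ... | no _ =
      does-⇔ (mk⇔ to from) (cyclic? 0 (2 * suc (c Y b u)) (suc (2 * p))) (c Y b u <? p)
      where
      to : Cyclic 0 (2 * suc (c Y b u)) (suc (2 * p)) → c Y b u < p
      to (pqr _ q<r) = *-cancelˡ-≤ 2 (s≤s⁻¹ q<r)
      from : c Y b u < p → Cyclic 0 (2 * suc (c Y b u)) (suc (2 * p))
      from c<p = pqr z<s (s≤s (*-monoʳ-≤ 2 c<p))

  insert-isTotalCyclicOrder : IsTotalCyclicOrder insert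
  insert-isTotalCyclicOrder = rankOrder-isTotalCyclicOrder newRank-injective

  ∂̄-insert : ∂̄ insert ≐ Y
  ∂̄-insert x y z = begin
    cyclicᵇ (newRank (inject₁ x)) (newRank (inject₁ y)) (newRank (inject₁ z))
      ≡⟨ cong₃ cyclicᵇ (newRank-old x) (newRank-old y) (newRank-old z) ⟩
    cyclicᵇ (2 * rank x) (2 * rank y) (2 * rank z) ≡⟨ cyclicᵇ-double (rank x) (rank y) (rank z) ⟩
    cyclicᵇ (rank x) (rank y) (rank z)             ≡⟨ sym (≐-rankOrder x y z) ⟩
    Y x y z                                        ∎
    where open ≡-Reasoning

  insert-between : ∀ {x} → x ≢ b → p ≤ c Y b x → (inject₁ b , fromℕ N , inject₁ x) ∈₃ insert
  insert-between {x} x≢b p≤c rewrite newRank-old b | newRank-last | newRank-old x | rank-base | rank-other x≢b =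
    dec-true (cyclic? _ _ _)
      (pqr z<s (subst (suc (2 * p) <_) (sym (*-suc 2 (c Y b x))) (s≤s (s≤s (*-monoʳ-≤ 2 p≤c)))))

  c-insert : ∀ {y} → y ≢ b → p ≤ c Y b y → c insert (inject₁ b) (fromℕ N) ≡ p
  c-insert y≢b p≤c = begin
    c insert (inject₁ b) (fromℕ N)                    ≡⟨ c≡count insert _ _ ⟩
    count (λ u → insert (inject₁ b) u (fromℕ N))
      ≡⟨ sum-init-last (λ u → boolToℕ (insert (inject₁ b) u (fromℕ N))) ⟩
    count (λ u → insert (inject₁ b) (inject₁ u) (fromℕ N))
      + boolToℕ (insert (inject₁ b) (fromℕ N) (fromℕ N))
      ≡⟨ cong₂ _+_ (count-cong old-below-last) (cong boolToℕ (∉-repeat₂₃′ (inject₁ b) (fromℕ N))) ⟩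
    count (below p) + 0                                ≡⟨ +-identityʳ _ ⟩
    count (below p)                                    ≡⟨ count-below y≢b p≤c ⟩
    p                                                  ∎
    where
    open ≡-Reasoning
    open TotalCyclicOrder insert-isTotalCyclicOrder using () renaming (∉-repeat₂₃ to ∉-repeat₂₃′)

lookup-∷ʳ-inject₁ : ∀ {n} {A : Set} (w : Vec A n) x t → lookup (w ∷ʳ x) (inject₁ t) ≡ lookup w t
lookup-∷ʳ-inject₁ (y ∷ w) x zero    = refl
lookup-∷ʳ-inject₁ (y ∷ w) x (suc t) = lookup-∷ʳ-inject₁ w x t

lookup-∷ʳ-last : ∀ {n} {A : Set} (w : Vec A n) x → lookup (w ∷ʳ x) (fromℕ n) ≡ x
lookup-∷ʳ-last []      x = refl
lookup-∷ʳ-last (y ∷ w) x = lookup-∷ʳ-last w x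

module _ {n : ℕ} (w : Vec Sign n) where
  P-last : ∀ {Z} → P (w ∷ʳ plus) Z → (inject₁ mm1 , inject₁ mm , mm) ∈₃ Z
  P-last (_ , letters) with lookup (w ∷ʳ plus) (fromℕ n) | lookup-∷ʳ-last w plus | letters (fromℕ n)
  ... | .plus | refl | letter = letter

  P-∂̄ : ∀ {s Z} → P (w ∷ʳ s) Z → P w (∂̄ Z)
  proj₁ (P-∂̄ (tZ , letters)) = ∂̄-isTotalCyclicOrder tZ
  proj₂ (P-∂̄ {s} (tZ , letters)) t
    with lookup w t | lookup (w ∷ʳ s) (inject₁ t) | lookup-∷ʳ-inject₁ w s t | letters (inject₁ t)
  ... | plus  | .plus  | refl | letter = letter
  ... | minus | .minus | refl | letter = letter

  P-extend : ∀ {Z Y} → IsTotalCyclicOrder Z → ∂̄ Z ≐ Y → P w Y →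
    (inject₁ mm1 , inject₁ mm , mm) ∈₃ Z → P (w ∷ʳ plus) Z
  proj₁ (P-extend tZ ∂̄Z≐Y pY lastLetter) = tZ
  proj₂ (P-extend tZ ∂̄Z≐Y (_ , letters) lastLetter) t with initOrLast t
  ... | last rewrite lookup-∷ʳ-last w plus = lastLetter
  ... | init u rewrite lookup-∷ʳ-inject₁ w plus u with lookup w u | letters u
  ...   | plus  | letter = trans (∂̄Z≐Y _ _ _) letter
  ...   | minus | letter = trans (∂̄Z≐Y _ _ _) letter

-- Fact names spell out points: O = 1, A = m − 1, B = m and M = m + 1, the deleted point.
module _ {n : ℕ} (w : Vec Sign (suc n)) {i j k : ℕ} where
  private
    Qp⁺ : Triples (4 + n) → Set
    Qp⁺ = Qp (w ∷ʳ plus) i j k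

  Qp-∂̄-minus : ∀ {Z} → Qp⁺ Z → (mm , inject₁ mm1 , inject₁ one) ∈₃ Z →
    Σ ℕ λ j′ → j′ < j × Qm w (i + j ∸ suc j′) j′ k (∂̄ Z)
  Qp-∂̄-minus {Z} (pZ@(tZ , _) , BMO , cBM , cMO , cOB) MAO =
    j′ , j′<j , P-∂̄ w pZ , OBA , cBA ,
    sym (c-∂̄-outside tZ (rotate (rotate MAO))) , trans (sym (c-∂̄-outside tZ BMO)) cOB
    where
    open TotalCyclicOrder tZ
    a j′ : ℕ
    a  = c Z mm (inject₁ mm1)
    j′ = c Z (inject₁ mm1) (inject₁ one)
    j≡ : j ≡ a + suc j′
    j≡ = trans (sym cMO) (c-additive MAO)
    j′<j : j′ < j
    j′<j = subst (j′ <_) (sym j≡) (m≤n+m (suc j′) a)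
    OBA : (one , mm , mm1) ∈₃ ∂̄ Z
    OBA = transitive (rotate (rotate BMO)) (rotate (rotate MAO))
    cBA : c (∂̄ Z) mm mm1 ≡ i + j ∸ suc j′
    cBA = begin
      c (∂̄ Z) mm mm1      ≡⟨ suc-injective (begin
        suc (c (∂̄ Z) mm mm1)            ≡⟨ sym (c-∂̄-inside Z (rotate (P-last w pZ))) ⟩
        c Z (inject₁ mm) (inject₁ mm1)  ≡⟨ c-additive (rotate (P-last w pZ)) ⟩
        c Z (inject₁ mm) mm + suc a      ≡⟨ cong (_+ suc a) cBM ⟩
        i + suc a                        ≡⟨ +-suc i a ⟩
        suc (i + a)                      ∎) ⟩
      i + a                ≡⟨ sym (m+n∸n≡m (i + a) (suc j′)) ⟩
      i + a + suc j′ ∸ suc j′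
        ≡⟨ cong (_∸ suc j′) (trans (+-assoc i a (suc j′)) (cong (i +_) (sym j≡))) ⟩
      i + j ∸ suc j′       ∎
      where open ≡-Reasoning

  Qp-∂̄-plus : ∀ {Z} → Qp⁺ Z → (inject₁ one , inject₁ mm1 , mm) ∈₃ Z →
    Σ ℕ λ k′ → k′ < k × Qp w (k ∸ suc k′) (i + j) k′ (∂̄ Z)
  Qp-∂̄-plus {Z} (pZ@(tZ , _) , BMO , cBM , cMO , cOB) OAM =
    k′ , k′<k , P-∂̄ w pZ , ABO , cAB , cBO , sym (c-∂̄-outside tZ (rotate OAM))
    where
    open TotalCyclicOrder tZ
    k′ x : ℕ
    k′ = c Z (inject₁ one) (inject₁ mm1)
    x  = c Z (inject₁ mm1) (inject₁ mm)
    ABO : (mm1 , mm , one) ∈₃ ∂̄ Z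
    ABO = transitive (P-last w pZ) (rotate OAM)
    k≡ : k ≡ k′ + suc x
    k≡ = trans (sym cOB) (c-additive (rotate (rotate ABO)))
    k′<k : k′ < k
    k′<k = subst (k′ <_) (sym k≡) (m<m+n k′ z<s)
    cAB : c (∂̄ Z) mm1 mm ≡ k ∸ suc k′
    cAB = begin
      c (∂̄ Z) mm1 mm   ≡⟨ sym (c-∂̄-outside tZ (rotate (P-last w pZ))) ⟩
      x                 ≡⟨ sym (m+n∸m≡n (suc k′) x) ⟩
      suc k′ + x ∸ suc k′ ≡⟨ cong (_∸ suc k′) (trans (sym (+-suc k′ x)) (sym k≡)) ⟩
      k ∸ suc k′        ∎
      where open ≡-Reasoning
    cBO : c (∂̄ Z) mm one ≡ i + j
    cBO = suc-injective (begin
      suc (c (∂̄ Z) mm one)             ≡⟨ sym (c-∂̄-inside Z BMO) ⟩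
      c Z (inject₁ mm) (inject₁ one)   ≡⟨ c-additive BMO ⟩
      c Z (inject₁ mm) mm + suc (c Z mm (inject₁ one)) ≡⟨ cong₂ (λ a b → a + suc b) cBM cMO ⟩
      i + suc j                         ≡⟨ +-suc i j ⟩
      suc (i + j)                       ∎)
      where open ≡-Reasoning

  Qp-∂̄ : ∀ {Z} → Qp⁺ Z → Target w i j k (∂̄ Z)
  Qp-∂̄ qZ@((tZ , _) , _)
    with TotalCyclicOrder.total tZ {mm} {inject₁ mm1} {inject₁ one} fromℕ≢inject₁ (λ ()) fromℕ≢inject₁
  ... | inj₁ MAO = inj₁ (Qp-∂̄-minus qZ MAO)
  ... | inj₂ OAM = inj₂ (Qp-∂̄-plus qZ OAM)

  Qp-from-∂̄ : ∀ {Z Y} → IsTotalCyclicOrder Z → ∂̄ Z ≐ Y → P w Y →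
    (inject₁ mm , mm , inject₁ mm1) ∈₃ Z → (inject₁ mm , mm , inject₁ one) ∈₃ Z →
    c Z (inject₁ mm) mm ≡ i → c Y mm one ≡ i + j → c Y one mm ≡ k → Qp⁺ Z
  Qp-from-∂̄ {Z} tZ ∂̄Z≐Y pY BMA BMO cBM cBO cOB =
    P-extend w tZ ∂̄Z≐Y pY (rotate (rotate BMA)) , BMO , cBM , cMO , cOB′
    where
    open TotalCyclicOrder tZ
    cMO : c Z mm (inject₁ one) ≡ j
    cMO = +-cancelˡ-≡ i _ _ (suc-injective (begin
      suc (i + c Z mm (inject₁ one))                    ≡⟨ sym (+-suc i _) ⟩
      i + suc (c Z mm (inject₁ one))                    ≡⟨ cong (_+ suc (c Z mm (inject₁ one))) (sym cBM) ⟩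
      c Z (inject₁ mm) mm + suc (c Z mm (inject₁ one))  ≡⟨ sym (c-additive BMO) ⟩
      c Z (inject₁ mm) (inject₁ one)                    ≡⟨ c-∂̄-inside Z BMO ⟩
      suc (c (∂̄ Z) mm one)                              ≡⟨ cong suc (trans (c-cong ∂̄Z≐Y mm one) cBO) ⟩
      suc (i + j)                                       ∎))
      where open ≡-Reasoning
    cOB′ : c Z (inject₁ one) (inject₁ mm) ≡ k
    cOB′ = trans (c-∂̄-outside tZ BMO) (trans (c-cong ∂̄Z≐Y one mm) cOB)

  Qp-lift : ∀ {Y} → P w Y → i ≤ c Y mm mm1 → c Y mm one ≡ i + j → c Y one mm ≡ k →
    Σ (Triples (4 + n)) λ Z → Qp⁺ Z × ∂̄ Z ≐ Y
  Qp-lift {Y} pY@(tY , _) i≤BA cBO cOB =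
    insert , Qp-from-∂̄ insert-isTotalCyclicOrder ∂̄-insert pY
      (insert-between (fromℕ≢inject₁ ∘ sym) i≤BA) (insert-between (λ ()) i≤BO)
      (c-insert {y = one} (λ ()) i≤BO) cBO cOB , ∂̄-insert
    where
    open Insertion tY mm i
    i≤BO : i ≤ c Y mm one
    i≤BO = subst (i ≤_) (sym cBO) (m≤m+n i j)

  Target-lift : ∀ {Y} → Target w i j k Y → Σ (Triples (4 + n)) λ Z → Qp⁺ Z × ∂̄ Z ≐ Y
  Target-lift {Y} (inj₁ (j′ , j′<j , pY@(tY , _) , OBA , cBA , cAO , cOB)) = Qp-lift pY i≤BA cBO cOB
    where
    open TotalCyclicOrder tY
    i≤BA : i ≤ c Y mm mm1
    i≤BA = subst (i ≤_) (sym (trans cBA (+-∸-assoc i j′<j))) (m≤m+n i _)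
    cBO : c Y mm one ≡ i + j
    cBO = trans (c-additive (rotate OBA))
      (trans (cong₂ (λ a b → a + suc b) cBA cAO) (m∸n+n≡m (≤-trans j′<j (m≤n+m j i))))
  Target-lift {Y} (inj₂ (k′ , k′<k , pY@(tY , _) , ABO , cAB , cBO , cOA)) = Qp-lift pY i≤BA cBO cOB
    where
    open TotalCyclicOrder tY
    i≤BA : i ≤ c Y mm mm1
    i≤BA = ≤-trans (subst (i ≤_) (sym cBO) (m≤m+n i j)) (<⇒≤ (c-strict (rotate ABO)))
    cOB : c Y one mm ≡ k
    cOB = trans (c-additive (rotate (rotate ABO)))
      (trans (cong₂ (λ a b → a + suc b) cOA cAB) (trans (+-suc k′ _) (m+[n∸m]≡n k′<k)))

lemma3 : (n : ℕ) → 1 ≤ n → (w : Vec Sign n) → (i j k : ℕ) → i + j + k ≡ n →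
    ((Z : Triples (3 + n)) → Qp (w ∷ʳ plus) i j k Z → Target w i j k (∂̄ Z))
    × ((Z Z' : Triples (3 + n)) → Qp (w ∷ʳ plus) i j k Z → Qp (w ∷ʳ plus) i j k Z' →
        ∂̄ Z ≐ ∂̄ Z' → Z ≐ Z')
    × ((Y : Triples (2 + n)) → Target w i j k Y →
        Σ (Triples (3 + n)) λ Z → Qp (w ∷ʳ plus) i j k Z × ∂̄ Z ≐ Y)
lemma3 (suc n) _ w i j k _ =
  (λ Z → Qp-∂̄ w) ,
  (λ { Z Z′ ((tZ , _) , _ , cBM , _) ((tZ′ , _) , _ , cBM′ , _) →
         ∂̄-injective tZ tZ′ mm (trans cBM (sym cBM′)) }) ,
  (λ Y → Target-lift w)
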